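{- Let $u,v,w$ be 012-strings for $X=\mathrm{Fl}(a,b;n)$ and let $P$ be an equivariant puzzle for $X$ with boundary $\triangle^{u,v}_w$. Then \[ \sum_{s}\mathcal{A}_T(s)=C_u\zeta^{11}+C_v\zeta^7+C_w\zeta^3, \] where the sum is over all small vertical rhombi $s$ of $P$ that are scabs.
   Context: A 012-string for $X$ has $a$ zeros, $b-a$ ones, $n-b$ twos. Labels are $0,\dots,7$ ($0,1,2$ simple); work in the plane tiled by unit equilateral triangles with a horizontal side. A triangular puzzle piece is a unit triangle whose labels, read counterclockwise, form a cyclic rotation of one of $(0,0,0),(1,1,1),(2,2,2),(3,0,1),(4,1,2),(5,0,2),(6,3,2),(7,0,4)$. A vertical equivariant piece is a unit rhombus (vertices top, bottom, left, right) with label $p$ on its SW–NE sides and $q$ on its NW–SE sides, $(p,q)\in\{(0,1),(1,2),(0,2),(3,2),(0,4),(3,4),(0,6),(7,2)\}$. An equivariant puzzle for $X$ with boundary $\triangle^{u,v}_w$ is a right-side-up triangle of side $n$ tiled by triangular pieces and vertical equivariant pieces with matching labels on shared edges, whose left, right, bottom border labels read left to right are $u,v,w$. Such $P$ dissects uniquely into $\binom n2$ small vertical rhombi and the $n$ triangles along the bottom; each small vertical rhombus is an equivariant piece or a union of two triangular pieces. A scab is a unit rhombus made of two triangular pieces with matching middle label that is not invariant under $180^\circ$ rotation. $R=\mathbb{C}[\delta_0,\delta_1,\delta_2]$, $R[y]=R[y_1,\dots,y_n]$, $\zeta=\exp(\pi i/6)$, $C_u=\sum_i\delta_{u_i}y_i$.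 Aura: a semi-labeled edge (edge with a label on one side) with simple label $a$ has aura $\mathcal{A}(e)=\delta_a v$, $v\in\mathbb{C}$ the unit normal pointing to the label's side; for composed labels the aura is determined by requiring that for each triangular piece the auras of its three sides, with labels placed inside, sum to zero. Number the bottom edges $1,\dots,n$ from the left. Edge weights: a NW–SE edge has weight $y_i$, $i$ the bottom edge reached by following a line parallel to the left border (south-west); a SW–NE edge has weight $y_j$, $j$ the bottom edge reached by following a line parallel to the right border (south-east); a horizontal edge has weight $y_i$ if it is the $i$-th bottom edge, and $0$ otherwise. The equivariant aura of a semi-labeled edge is $\mathcal{A}_T(e)=\operatorname{weight}(e)\mathcal{A}(e)$; for a piece $q$, $\mathcal{A}_T(q)$ is the sum of the equivariant auras of its sides with labels placed inside $q$; for a small vertical rhombus $s$ consisting of two triangular pieces, $\mathcal{A}_T(s)$ is the sum of the equivariant auras of these two pieces. -}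

module Defs where

open import Data.Nat as ℕ using (ℕ; zero; suc; _+_; _∸_; _≤_)
open import Data.Integer as ℤ using (ℤ; +_; -_) renaming (_+_ to _+ℤ_)
open import Data.Fin using (Fin; zero; suc; toℕ; #_; _≟_)
open import Data.Bool using (Bool; true; false; not; _∧_; if_then_else_)
open import Data.Maybe using (Maybe; just; nothing)
open import Data.Product using (_×_; _,_)
open import Data.Sum using (_⊎_)
open import Data.List using (List; []; _∷_)
open import Data.List.Membership.Propositional using (_∈_)
open import Data.List.Relation.Unary.Any using (here; there)
open import Relation.Binary.PropositionalEquality using (_≡_; refl)
open import Relation.Nullary using (does)

-- The ring ℤ[ζ] ⊂ ℂ, ζ = exp(πi/6), a primitive 12th root of unity.
-- Minimal polynomial of ζ: x⁴ − x² + 1, so ℤ[ζ] ≅ ℤ[x]/(x⁴ − x² + 1)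
-- with ℤ-basis 1, ζ, ζ², ζ³ (canonical representatives, hence ≡ is
-- equality of complex numbers).  All complex scalars occurring in the
-- statement (unit normals, ζ^k) lie in ℤ[ζ].

record Zζ : Set where
  constructor ⟨_,_,_,_⟩
  field
    c0 c1 c2 c3 : ℤ

0ζ : Zζ
0ζ = ⟨ + 0 , + 0 , + 0 , + 0 ⟩

1ζ : Zζ
1ζ = ⟨ + 1 , + 0 , + 0 , + 0 ⟩

infixl 6 _⊹_
_⊹_ : Zζ → Zζ → Zζ
⟨ a0 , a1 , a2 , a3 ⟩ ⊹ ⟨ b0 , b1 , b2 , b3 ⟩ =
  ⟨ a0 +ℤ b0 , a1 +ℤ b1 , a2 +ℤ b2 , a3 +ℤ b3 ⟩

-- multiplication by ζ, using ζ⁴ = ζ² − 1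
mulζ : Zζ → Zζ
mulζ ⟨ a0 , a1 , a2 , a3 ⟩ = ⟨ - a3 , a0 , a1 +ℤ a3 , a2 ⟩

rot : ℕ → Zζ → Zζ
rot zero x = x
rot (suc k) x = mulζ (rot k x)

ζ^ : ℕ → Zζ
ζ^ k = rot k 1ζ

Label : Set
Label = Fin 8

simple : Fin 3 → Label
simple zero = # 0
simple (suc zero) = # 1
simple (suc (suc zero)) = # 2

-- Triangular puzzle pieces: labels read counterclockwise form a cyclic
-- rotation of one of the following triples.
pieceList : List (Label × Label × Label)
pieceList =
  (# 0 , # 0 , # 0) ∷ (# 1 , # 1 , # 1) ∷ (# 2 , # 2 , # 2) ∷
  (# 3 , # 0 , # 1) ∷ (# 4 , # 1 , # 2) ∷ (# 5 , # 0 , # 2) ∷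
  (# 6 , # 3 , # 2) ∷ (# 7 , # 0 , # 4) ∷ []

IsPiece : Label → Label → Label → Set
IsPiece x y z =
  (x , y , z) ∈ pieceList ⊎ (y , z , x) ∈ pieceList ⊎ (z , x , y) ∈ pieceList

-- Vertical equivariant pieces (p on SW–NE sides, q on NW–SE sides).
eqPieceList : List (Label × Label)
eqPieceList =
  (# 0 , # 1) ∷ (# 1 , # 2) ∷ (# 0 , # 2) ∷ (# 3 , # 2) ∷
  (# 0 , # 4) ∷ (# 3 , # 4) ∷ (# 0 , # 6) ∷ (# 7 , # 2) ∷ []

IsEqPiece : Label → Label → Set
IsEqPiece p q = (p , q) ∈ eqPieceList

-- A label L on an edge whose unit normal (towards the label's
-- side) is v has aura  v · β L,  where β L ∈ ℤ[ζ]δ₀ ⊕ ℤ[ζ]δ₁ ⊕ ℤ[ζ]δ₂ is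
-- given by its δ-coefficients  auraCoeff L a  (a ∈ {0,1,2}).  Composed labels: forced by the requirement
-- that each triangular piece has total aura 0 (checked in
-- `aura-balanced` below): for an upward triangle with counterclockwise
-- labels (x,y,z) on bottom, right, left, inward normals are ζ³, ζ⁷, ζ¹¹,
-- so  β x + ζ⁴ β y + ζ⁸ β z = 0.
--   β3 = ζ¹⁰δ₀ + ζ²δ₁,  β4 = ζ¹⁰δ₁ + ζ²δ₂,  β5 = ζ¹⁰δ₀ + ζ²δ₂,
--   β6 = ζ⁸δ₀ + δ₁ + ζ²δ₂,  β7 = ζ¹⁰δ₀ + δ₁ + ζ⁴δ₂.

auraCoeff : Label → Fin 3 → Zζ
auraCoeff zero zero = 1ζ
auraCoeff zero (suc _) = 0ζ
auraCoeff (suc zero) zero = 0ζ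
auraCoeff (suc zero) (suc zero) = 1ζ
auraCoeff (suc zero) (suc (suc _)) = 0ζ
auraCoeff (suc (suc zero)) (suc (suc zero)) = 1ζ
auraCoeff (suc (suc zero)) _ = 0ζ
auraCoeff (suc (suc (suc zero))) zero = ζ^ 10
auraCoeff (suc (suc (suc zero))) (suc zero) = ζ^ 2
auraCoeff (suc (suc (suc zero))) (suc (suc _)) = 0ζ
auraCoeff (suc (suc (suc (suc zero)))) zero = 0ζ
auraCoeff (suc (suc (suc (suc zero)))) (suc zero) = ζ^ 10
auraCoeff (suc (suc (suc (suc zero)))) (suc (suc _)) = ζ^ 2
auraCoeff (suc (suc (suc (suc (suc zero))))) zero = ζ^ 10
auraCoeff (suc (suc (suc (suc (suc zero))))) (suc zero) = 0ζ
auraCoeff (suc (suc (suc (suc (suc zero))))) (suc (suc _)) = ζ^ 2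
auraCoeff (suc (suc (suc (suc (suc (suc zero)))))) zero = ζ^ 8
auraCoeff (suc (suc (suc (suc (suc (suc zero)))))) (suc zero) = 1ζ
auraCoeff (suc (suc (suc (suc (suc (suc zero)))))) (suc (suc _)) = ζ^ 2
auraCoeff (suc (suc (suc (suc (suc (suc (suc _))))))) zero = ζ^ 10
auraCoeff (suc (suc (suc (suc (suc (suc (suc _))))))) (suc zero) = 1ζ
auraCoeff (suc (suc (suc (suc (suc (suc (suc _))))))) (suc (suc _)) = ζ^ 4

aura-balanced : ∀ {x y z} → (x , y , z) ∈ pieceList → ∀ c →
  auraCoeff x c ⊹ rot 4 (auraCoeff y c) ⊹ rot 8 (auraCoeff z c) ≡ 0ζ
aura-balanced (here refl) zero = refl
aura-balanced (here refl) (suc zero) = refl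
aura-balanced (here refl) (suc (suc zero)) = refl
aura-balanced (there (here refl)) zero = refl
aura-balanced (there (here refl)) (suc zero) = refl
aura-balanced (there (here refl)) (suc (suc zero)) = refl
aura-balanced (there (there (here refl))) zero = refl
aura-balanced (there (there (here refl))) (suc zero) = refl
aura-balanced (there (there (here refl))) (suc (suc zero)) = refl
aura-balanced (there (there (there (here refl)))) zero = refl
aura-balanced (there (there (there (here refl)))) (suc zero) = refl
aura-balanced (there (there (there (here refl)))) (suc (suc zero)) = refl
aura-balanced (there (there (there (there (here refl))))) zero = refl
aura-balanced (there (there (there (there (here refl))))) (suc zero) = refl
aura-balanced (there (there (there (there (here refl))))) (suc (suc zero)) = refl
aura-balanced (there (there (there (there (there (here refl)))))) zero = refl
aura-balanced (there (there (there (there (there (here refl)))))) (suc zero) = refl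
aura-balanced (there (there (there (there (there (here refl)))))) (suc (suc zero)) = refl
aura-balanced (there (there (there (there (there (there (here refl))))))) zero = refl
aura-balanced (there (there (there (there (there (there (here refl))))))) (suc zero) = refl
aura-balanced (there (there (there (there (there (there (here refl))))))) (suc (suc zero)) = refl
aura-balanced (there (there (there (there (there (there (there (here refl)))))))) zero = refl
aura-balanced (there (there (there (there (there (there (there (here refl)))))))) (suc zero) = refl
aura-balanced (there (there (there (there (there (there (there (here refl)))))))) (suc (suc zero)) = refl
aura-balanced (there (there (there (there (there (there (there (there ())))))))) _

-- The relevant part of R[y]: ℂ-linear combinations of the monomials
-- δ_a y_j (a ∈ {0,1,2}, j ∈ {1,…,n}).  Every quantity in the statement
-- lies in  ⊕_{a,j} ℤ[ζ] δ_a y_j ; an element is given by its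
-- coefficient function.  (Fin n index j ↦ variable y_{j+1}.)

Lin : ℕ → Set
Lin n = Fin 3 → Fin n → Zζ

0L : ∀ {n} → Lin n
0L _ _ = 0ζ

infixl 6 _⊕_
_⊕_ : ∀ {n} → Lin n → Lin n → Lin n
(f ⊕ g) a j = f a j ⊹ g a j

sumRange : ∀ {n} → ℕ → (ℕ → Lin n) → Lin n
sumRange zero f = 0L
sumRange (suc m) f = sumRange m f ⊕ f m

-- Equivariant aura of a semi-labeled edge carrying label L, whose unit
-- normal towards the label is ζ^k, with weight y_{i+1} (just i) or 0
-- (nothing):  weight · ζ^k · β L.
edgeAT : ∀ {n} → Label → ℕ → Maybe ℕ → Lin n
edgeAT L k nothing a j = 0ζ
edgeAT L k (just i) a j =
  if does (i ℕ.≟ toℕ j) then rot k (auraCoeff L a) else 0ζ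

count : ∀ {n} → (Fin n → Fin 3) → Fin 3 → ℕ
count {zero} u c = 0
count {suc n} u c =
  (if does (u zero ≟ c) then 1 else 0) + count (λ k → u (suc k)) c

Is012String : ℕ → ℕ → (n : ℕ) → (Fin n → Fin 3) → Set
Is012String a b n u =
  count u (# 0) ≡ a × count u (# 1) ≡ b ∸ a × count u (# 2) ≡ n ∸ b

Cstr : ∀ {n} → (Fin n → Fin 3) → Lin n
Cstr u a j = if does (u j ≟ a) then 1ζ else 0ζ

scaleL : ∀ {n} → ℕ → Lin n → Lin n
scaleL k f a j = rot k (f a j)

-- Vertices of the size-n triangle: (i,j), i,j ≥ 0, i+j ≤ n,
-- at position i·e₁ + j·e₂ with e₁ = 1 (east), e₂ = ζ² (north-east);
-- (0,0) is the bottom-left corner.  For i + j < n: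
--   H i j : horizontal edge   (i,j)–(i+1,j)
--   D i j : SW–NE edge        (i,j)–(i,j+1)
--   A i j : NW–SE edge        (i+1,j)–(i,j+1)
-- Upward triangle (i,j), i+j < n: sides H i j (bottom), A i j (right),
--   D i j (left); inward normals ζ³, ζ⁷, ζ¹¹.
-- Downward triangle (i,j), i+j+2 ≤ n: sides A i j (lower left),
--   D (i+1) j (lower right), H i (j+1) (top); inward normals ζ, ζ⁵, ζ⁹.
-- Small vertical rhombus (i,j), i+j+2 ≤ n: upward triangle (i,j+1) on
--   top of downward triangle (i,j); SW–NE sides D (i+1) j, D i (j+1);
--   NW–SE sides A i j, A i (j+1); middle edge H i (j+1).
-- The n remaining triangles are the upward triangles (i,0).
-- Bottom edges H i 0 are numbered i+1.  Weights:
--   A i j ↦ y_{i+1},  D i j ↦ y_{i+j+1},  H i 0 ↦ y_{i+1}, H i (j+1) ↦ 0.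

weightH : ℕ → ℕ → Maybe ℕ
weightH i zero = just i
weightH i (suc j) = nothing

weightA : ℕ → ℕ → Maybe ℕ
weightA i j = just i

weightD : ℕ → ℕ → Maybe ℕ
weightD i j = just (i + j)

-- The labels of
-- edges are given by hL, dL, aL (values outside the triangle are
-- irrelevant); equiv i j says whether the small vertical rhombus (i,j)
-- is a vertical equivariant piece (then its middle edge is not an edge
-- of the puzzle and hL i (j+1) is irrelevant) or a union of two
-- triangular pieces.
record EqPuzzle (n : ℕ) (u v w : Fin n → Fin 3) : Set where
  field
    hL dL aL : ℕ → ℕ → Label
    equiv : ℕ → ℕ → Bool
    bottomPiece : ∀ i → suc i ≤ n → IsPiece (hL i 0) (aL i 0) (dL i 0)
    rhombusEquiv : ∀ i j → i + j + 2 ≤ n → equiv i j ≡ true →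
      IsEqPiece (dL (suc i) j) (aL i j)
      × dL i (suc j) ≡ dL (suc i) j
      × aL i (suc j) ≡ aL i j
    rhombusTriangles : ∀ i j → i + j + 2 ≤ n → equiv i j ≡ false →
      IsPiece (hL i (suc j)) (aL i (suc j)) (dL i (suc j))
      × IsPiece (aL i j) (dL (suc i) j) (hL i (suc j))
    -- boundary, each side read left to right
    leftBoundary : ∀ k → dL 0 (toℕ k) ≡ simple (u k)
    rightBoundary : ∀ k → aL (toℕ k) (n ∸ suc (toℕ k)) ≡ simple (v k)
    bottomBoundary : ∀ k → hL (toℕ k) 0 ≡ simple (w k)

module _ {n : ℕ} {u v w : Fin n → Fin 3} (P : EqPuzzle n u v w) where
  open EqPuzzle P

  -- rhombus (i,j) is a scab: two triangular pieces, and not invariant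
  -- under 180° rotation (which swaps A i j ↔ A i (j+1) and
  -- D (i+1) j ↔ D i (j+1) and fixes the middle edge)
  isScab : ℕ → ℕ → Bool
  isScab i j = not (equiv i j) ∧
    not (does (aL i j ≟ aL i (suc j)) ∧ does (dL (suc i) j ≟ dL i (suc j)))

  rhombusAT : ℕ → ℕ → Lin n
  rhombusAT i j =
    edgeAT (hL i (suc j)) 3 (weightH i (suc j))
    ⊕ edgeAT (aL i (suc j)) 7 (weightA i (suc j))
    ⊕ edgeAT (dL i (suc j)) 11 (weightD i (suc j))
    ⊕ edgeAT (aL i j) 1 (weightA i j)
    ⊕ edgeAT (dL (suc i) j) 5 (weightD (suc i) j)
    ⊕ edgeAT (hL i (suc j)) 9 (weightH i (suc j))

  scabSum : Lin n
  scabSum = sumRange (n ∸ 1) λ i → sumRange (n ∸ 1 ∸ i) λ j →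
    if isScab i j then rhombusAT i j else 0L

module Submission where

-- Fix one coefficient, of δ_c y_{m+1}; everything happens in
-- ℤ[ζ] and only edges of weight y_{m+1} contribute.
--  * A rhombus that is not a scab (an equivariant piece, or invariant under
--    the 180° rotation) has equal labels and weights but opposite normals on
--    opposite sides, so its aura vanishes: the scab sum is the sum over ALL
--    small vertical rhombi.
--  * The middle edge of a rhombus has weight 0, interior edges appear twice
--    with opposite normals (ζ⁶ = −1), and the bottom triangles have aura 0 by
--    the defining property of auras; so the sum telescopes, strip by strip
--    between consecutive SW–NE columns, to the aura of the boundary.
--  * On each border side only the m-th edge has weight y_{m+1}; its label is
--    simple, giving ζ¹¹C_u, ζ⁷C_v, ζ³C_w.

open import Defs
open import Data.Nat using (ℕ; _≤_)
open import Data.Fin using (Fin)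
open import Relation.Binary.PropositionalEquality using (_≡_)

open import Level using (0ℓ)
open import Data.Nat as ℕ using (zero; suc; _+_; _∸_; _<_; s≤s)
import Data.Nat.Properties as ℕP
import Data.Nat.Tactic.RingSolver as ℕSolver
open import Data.Integer as ℤ using (ℤ; -_) renaming (_+_ to _+ℤ_)
import Data.Integer.Properties as ℤP
import Data.Integer.Tactic.RingSolver as ℤSolver
open import Data.Fin as F using (toℕ; zero; suc)
import Data.Fin.Properties as FP
open import Data.Bool using (true; false; not; _∧_; if_then_else_)
open import Data.Maybe using (just)
open import Data.Product using (_×_; _,_)
open import Data.Sum using (_⊎_; inj₁; inj₂)
open import Data.Empty using (⊥-elim)
open import Data.List.Membership.Propositional using (_∈_)
open import Relation.Nullary using (Dec; yes; no; does; ¬_)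
open import Relation.Binary.PropositionalEquality
  using (refl; sym; trans; cong; cong₂; isEquivalence; _≢_; module ≡-Reasoning)
open import Algebra.Bundles using (CommutativeMonoid)

coords≡ : ∀ {a0 a1 a2 a3 b0 b1 b2 b3 : ℤ} →
  a0 ≡ b0 → a1 ≡ b1 → a2 ≡ b2 → a3 ≡ b3 → ⟨ a0 , a1 , a2 , a3 ⟩ ≡ ⟨ b0 , b1 , b2 , b3 ⟩
coords≡ refl refl refl refl = refl

⊹-assoc : ∀ x y z → (x ⊹ y) ⊹ z ≡ x ⊹ (y ⊹ z)
⊹-assoc ⟨ a0 , a1 , a2 , a3 ⟩ ⟨ b0 , b1 , b2 , b3 ⟩ ⟨ c0 , c1 , c2 , c3 ⟩ =
  coords≡ (ℤP.+-assoc a0 b0 c0) (ℤP.+-assoc a1 b1 c1) (ℤP.+-assoc a2 b2 c2) (ℤP.+-assoc a3 b3 c3)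

⊹-comm : ∀ x y → x ⊹ y ≡ y ⊹ x
⊹-comm ⟨ a0 , a1 , a2 , a3 ⟩ ⟨ b0 , b1 , b2 , b3 ⟩ =
  coords≡ (ℤP.+-comm a0 b0) (ℤP.+-comm a1 b1) (ℤP.+-comm a2 b2) (ℤP.+-comm a3 b3)

⊹-identityˡ : ∀ x → 0ζ ⊹ x ≡ x
⊹-identityˡ ⟨ a0 , a1 , a2 , a3 ⟩ =
  coords≡ (ℤP.+-identityˡ a0) (ℤP.+-identityˡ a1) (ℤP.+-identityˡ a2) (ℤP.+-identityˡ a3)

⊹-identityʳ : ∀ x → x ⊹ 0ζ ≡ x
⊹-identityʳ x = trans (⊹-comm x 0ζ) (⊹-identityˡ x)

ℤ[ζ]-+-commutativeMonoid : CommutativeMonoid 0ℓ 0ℓ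
ℤ[ζ]-+-commutativeMonoid = record
  { Carrier = Zζ ; _≈_ = _≡_ ; _∙_ = _⊹_ ; ε = 0ζ
  ; isCommutativeMonoid = record
    { isMonoid = record
      { isSemigroup = record
        { isMagma = record { isEquivalence = isEquivalence ; ∙-cong = cong₂ _⊹_ }
        ; assoc = ⊹-assoc }
      ; identity = ⊹-identityˡ , ⊹-identityʳ }
    ; comm = ⊹-comm } }

open import Algebra.Solver.CommutativeMonoid ℤ[ζ]-+-commutativeMonoid
  using (solve; _⊜_; id) renaming (_⊕_ to _⊛_)

mulζ-⊹ : ∀ x y → mulζ (x ⊹ y) ≡ mulζ x ⊹ mulζ y
mulζ-⊹ ⟨ a0 , a1 , a2 , a3 ⟩ ⟨ b0 , b1 , b2 , b3 ⟩ =
  coords≡ (ℤP.neg-distrib-+ a3 b3) refl (interchange a1 b1 a3 b3) refl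
  where
  interchange : ∀ a b c d → (a +ℤ b) +ℤ (c +ℤ d) ≡ (a +ℤ c) +ℤ (b +ℤ d)
  interchange = ℤSolver.solve-∀

rot-⊹ : ∀ k x y → rot k (x ⊹ y) ≡ rot k x ⊹ rot k y
rot-⊹ zero x y = refl
rot-⊹ (suc k) x y = trans (cong mulζ (rot-⊹ k x y)) (mulζ-⊹ (rot k x) (rot k y))

rot-0ζ : ∀ k → rot k 0ζ ≡ 0ζ
rot-0ζ zero = refl
rot-0ζ (suc k) = cong mulζ (rot-0ζ k)

rot-3 : ∀ a b c d → rot 3 ⟨ a , b , c , d ⟩ ≡ ⟨ - (b +ℤ d) , - c , b , a +ℤ c ⟩
rot-3 a b c d = cong (λ z → ⟨ - (b +ℤ d) , - c , z , a +ℤ c ⟩) (cancel b d)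
  where
  cancel : ∀ b d → - d +ℤ (b +ℤ d) ≡ b
  cancel = ℤSolver.solve-∀

rot-6 : ∀ a b c d → rot 6 ⟨ a , b , c , d ⟩ ≡ ⟨ - a , - b , - c , - d ⟩
rot-6 a b c d = trans (cong (rot 3) (rot-3 a b c d))
  (trans (rot-3 (- (b +ℤ d)) (- c) b (a +ℤ c)) (coords≡ (first a c) refl refl (last b d)))
  where
  first : ∀ a c → - (- c +ℤ (a +ℤ c)) ≡ - a
  first = ℤSolver.solve-∀
  last : ∀ b d → - (b +ℤ d) +ℤ b ≡ - d
  last = ℤSolver.solve-∀

-- The same edge seen from its two sides: normals ζ^(k+6) and ζ^k cancel.
half-turn : ∀ x → rot 6 x ⊹ x ≡ 0ζ
half-turn ⟨ a , b , c , d ⟩ = trans (cong (_⊹ ⟨ a , b , c , d ⟩) (rot-6 a b c d))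
  (coords≡ (ℤP.+-inverseˡ a) (ℤP.+-inverseˡ b) (ℤP.+-inverseˡ c) (ℤP.+-inverseˡ d))

-- ζ¹² = 1; needed to read the piece relations starting from another side.
full-turn : ∀ x → rot 12 x ≡ x
full-turn ⟨ a , b , c , d ⟩ = trans (cong (rot 6) (rot-6 a b c d))
  (trans (rot-6 (- a) (- b) (- c) (- d))
    (coords≡ (ℤP.neg-involutive a) (ℤP.neg-involutive b) (ℤP.neg-involutive c) (ℤP.neg-involutive d)))

sumζ : ℕ → (ℕ → Zζ) → Zζ
sumζ zero f = 0ζ
sumζ (suc K) f = sumζ K f ⊹ f K

sumRange-coeff : ∀ {n} K (f : ℕ → Lin n) a j → sumRange K f a j ≡ sumζ K (λ k → f k a j)
sumRange-coeff zero f a j = refl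
sumRange-coeff (suc K) f a j = cong (_⊹ f K a j) (sumRange-coeff K f a j)

sum-cong : ∀ K {f g : ℕ → Zζ} → (∀ k → k < K → f k ≡ g k) → sumζ K f ≡ sumζ K g
sum-cong zero eq = refl
sum-cong (suc K) eq = cong₂ _⊹_ (sum-cong K (λ k k<K → eq k (ℕP.m≤n⇒m≤1+n k<K))) (eq K ℕP.≤-refl)

sum-zero : ∀ K {f : ℕ → Zζ} → (∀ k → k < K → f k ≡ 0ζ) → sumζ K f ≡ 0ζ
sum-zero K {f} eq = trans (sum-cong K eq) (zeros K)
  where
  zeros : ∀ K → sumζ K (λ _ → 0ζ) ≡ 0ζ
  zeros zero = refl
  zeros (suc K) = trans (⊹-identityʳ _) (zeros K)

sum-⊹ : ∀ K f g → sumζ K (λ k → f k ⊹ g k) ≡ sumζ K f ⊹ sumζ K g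
sum-⊹ zero f g = refl
sum-⊹ (suc K) f g = trans (cong (_⊹ (f K ⊹ g K)) (sum-⊹ K f g))
  (solve 4 (λ a b c d → (a ⊛ b) ⊛ (c ⊛ d) ⊜ (a ⊛ c) ⊛ (b ⊛ d)) refl
    (sumζ K f) (sumζ K g) (f K) (g K))

sum-first : ∀ K f → sumζ (suc K) f ≡ f 0 ⊹ sumζ K (λ k → f (suc k))
sum-first zero f = ⊹-comm 0ζ (f 0)
sum-first (suc K) f =
  trans (cong (_⊹ f (suc K)) (sum-first K f)) (⊹-assoc (f 0) (sumζ K (λ k → f (suc k))) (f (suc K)))

telescope : ∀ (p q : ℕ → Zζ) → (∀ k → p k ⊹ q k ≡ 0ζ) →
  ∀ K → sumζ K (λ k → p k ⊹ q (suc k)) ≡ p 0 ⊹ q K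
telescope p q cancel zero = sym (cancel 0)
telescope p q cancel (suc K) = begin
    sumζ K (λ k → p k ⊹ q (suc k)) ⊹ (p K ⊹ q (suc K))
  ≡⟨ cong (_⊹ (p K ⊹ q (suc K))) (telescope p q cancel K) ⟩
    (p 0 ⊹ q K) ⊹ (p K ⊹ q (suc K))
  ≡⟨ solve 4 (λ a b c d → (a ⊛ b) ⊛ (c ⊛ d) ⊜ a ⊛ ((c ⊛ b) ⊛ d)) refl (p 0) (q K) (p K) (q (suc K)) ⟩
    p 0 ⊹ ((p K ⊹ q K) ⊹ q (suc K))
  ≡⟨ cong (λ t → p 0 ⊹ (t ⊹ q (suc K))) (cancel K) ⟩
    p 0 ⊹ (0ζ ⊹ q (suc K))
  ≡⟨ cong (p 0 ⊹_) (⊹-identityˡ (q (suc K))) ⟩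
    p 0 ⊹ q (suc K) ∎
  where open ≡-Reasoning

sum-single : ∀ K f m → m < K → (∀ k → k ≢ m → f k ≡ 0ζ) → sumζ K f ≡ f m
sum-single (suc K) f m m<1+K off with m ℕ.≟ K
... | yes refl = trans (cong (_⊹ f m) (sum-zero K (λ k k<m → off k (ℕP.<⇒≢ k<m))))
                       (⊹-identityˡ (f m))
... | no m≢K = trans (cong₂ _⊹_ (sum-single K f m (ℕP.≤∧≢⇒< (ℕP.≤-pred m<1+K) m≢K) off)
                                (off K (λ K≡m → m≢K (sym K≡m))))
                     (⊹-identityʳ (f m))

rotated-balance : ∀ k {x y z} → (x , y , z) ∈ pieceList → ∀ c →
  rot k (auraCoeff x c) ⊹ rot k (rot 4 (auraCoeff y c)) ⊹ rot k (rot 8 (auraCoeff z c)) ≡ 0ζ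
rotated-balance k {x} {y} {z} p c = begin
    rot k (auraCoeff x c) ⊹ rot k (rot 4 (auraCoeff y c)) ⊹ rot k (rot 8 (auraCoeff z c))
  ≡⟨ cong (_⊹ rot k (rot 8 (auraCoeff z c))) (sym (rot-⊹ k _ _)) ⟩
    rot k (auraCoeff x c ⊹ rot 4 (auraCoeff y c)) ⊹ rot k (rot 8 (auraCoeff z c))
  ≡⟨ sym (rot-⊹ k _ _) ⟩
    rot k (auraCoeff x c ⊹ rot 4 (auraCoeff y c) ⊹ rot 8 (auraCoeff z c))
  ≡⟨ cong (rot k) (aura-balanced p c) ⟩
    rot k 0ζ
  ≡⟨ rot-0ζ k ⟩
    0ζ ∎
  where open ≡-Reasoning

cyclic : ∀ a b c → a ⊹ b ⊹ c ≡ 0ζ → b ⊹ c ⊹ a ≡ 0ζ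
cyclic a b c eq = trans (solve 3 (λ a b c → (b ⊛ c) ⊛ a ⊜ (a ⊛ b) ⊛ c) refl a b c) eq

-- Every triangular piece has total aura 0: with labels x, y, z on the
-- bottom, right and left side of an upward triangle (inward normals ζ³, ζ⁷,
-- ζ¹¹), ζ³β x + ζ⁷β y + ζ¹¹β z = 0.  The three cases are the three cyclic
-- readings in IsPiece; ζ¹² = 1 brings the rotated relation back.
piece-balance : ∀ {x y z} → IsPiece x y z → ∀ c →
  rot 3 (auraCoeff x c) ⊹ rot 7 (auraCoeff y c) ⊹ rot 11 (auraCoeff z c) ≡ 0ζ
piece-balance (inj₁ p) c = rotated-balance 3 p c
piece-balance {x} {y} {z} (inj₂ (inj₁ p)) c =
  cyclic (rot 11 (auraCoeff z c)) (rot 3 (auraCoeff x c)) (rot 7 (auraCoeff y c))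
   (cyclic (rot 7 (auraCoeff y c)) (rot 11 (auraCoeff z c)) (rot 3 (auraCoeff x c))
    (trans (cong (λ t → rot 7 (auraCoeff y c) ⊹ rot 11 (auraCoeff z c) ⊹ rot 3 t)
                 (sym (full-turn (auraCoeff x c))))
           (rotated-balance 7 p c)))
piece-balance {x} {y} {z} (inj₂ (inj₂ p)) c =
  cyclic (rot 11 (auraCoeff z c)) (rot 3 (auraCoeff x c)) (rot 7 (auraCoeff y c))
    (trans (cong₂ (λ s t → rot 11 (auraCoeff z c) ⊹ rot 3 s ⊹ rot 7 t)
                  (sym (full-turn (auraCoeff x c))) (sym (full-turn (auraCoeff y c))))
           (rotated-balance 11 p c))

simple-aura : ∀ a c → auraCoeff (simple a) c ≡ (if does (a F.≟ c) then 1ζ else 0ζ)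
simple-aura zero zero = refl
simple-aura zero (suc zero) = refl
simple-aura zero (suc (suc zero)) = refl
simple-aura (suc zero) zero = refl
simple-aura (suc zero) (suc zero) = refl
simple-aura (suc zero) (suc (suc zero)) = refl
simple-aura (suc (suc zero)) zero = refl
simple-aura (suc (suc zero)) (suc zero) = refl
simple-aura (suc (suc zero)) (suc (suc zero)) = refl

rhombus-inside : ∀ n' i j → i < n' → j < n' ∸ i → i + j + 2 ≤ suc n'
rhombus-inside n' i j i<n' j<K =
  ℕP.≤-trans (ℕP.≤-reflexive (reorder i j)) (s≤s (ℕP.m≤o∸n⇒m+n≤o (suc j) (ℕP.<⇒≤ i<n') j<K))
  where
  reorder : ∀ i j → i + j + 2 ≡ suc (suc j + i)
  reorder = ℕSolver.solve-∀

guard-cases : ∀ {A : Set} (d : Dec A) →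
  (A × ∀ x → (if does d then x else 0ζ) ≡ x) ⊎ (¬ A × ∀ x → (if does d then x else 0ζ) ≡ 0ζ)
guard-cases (yes a) = inj₁ (a , λ _ → refl)
guard-cases (no ¬a) = inj₂ (¬a , λ _ → refl)

module CoefficientOf {n' : ℕ} {u v w : Fin (suc n') → Fin 3}
  (P : EqPuzzle (suc n') u v w) (c : Fin 3) (jj : Fin (suc n')) where
  open EqPuzzle P
  open ≡-Reasoning

  m : ℕ
  m = toℕ jj

  edge : ℕ → Label → ℕ → Zζ
  edge k L i = edgeAT {suc n'} L k (just i) c jj

  edge-cases : ∀ i →
    (i ≡ m × ∀ k L → edge k L i ≡ rot k (auraCoeff L c)) ⊎ (i ≢ m × ∀ k L → edge k L i ≡ 0ζ)
  edge-cases i with guard-cases (i ℕ.≟ m)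
  ... | inj₁ (i≡m , on) = inj₁ (i≡m , λ k L → on (rot k (auraCoeff L c)))
  ... | inj₂ (i≢m , off) = inj₂ (i≢m , λ k L → off (rot k (auraCoeff L c)))

  edge-off : ∀ k L i → i ≢ m → edge k L i ≡ 0ζ
  edge-off k L i i≢m with edge-cases i
  ... | inj₁ (i≡m , _) = ⊥-elim (i≢m i≡m)
  ... | inj₂ (_ , off) = off k L

  edge-on : ∀ k L → edge k L m ≡ rot k (auraCoeff L c)
  edge-on k L with edge-cases m
  ... | inj₁ (_ , on) = on k L
  ... | inj₂ (m≢m , _) = ⊥-elim (m≢m refl)

  edge-opposite : ∀ k L i → edge (6 + k) L i ⊹ edge k L i ≡ 0ζ
  edge-opposite k L i with edge-cases i
  ... | inj₁ (_ , on) rewrite on (6 + k) L | on k L = half-turn (rot k (auraCoeff L c))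
  ... | inj₂ (_ , off) rewrite off (6 + k) L | off k L = refl

  piece-aura : ∀ i {x y z} → IsPiece x y z → edge 3 x i ⊹ edge 7 y i ⊹ edge 11 z i ≡ 0ζ
  piece-aura i {x} {y} {z} p with edge-cases i
  ... | inj₁ (_ , on) rewrite on 3 x | on 7 y | on 11 z = piece-balance p c
  ... | inj₂ (_ , off) rewrite off 3 x | off 7 y | off 11 z = refl

  aEdge : ℕ → ℕ → ℕ → Zζ
  aEdge k i j = edge k (aL i j) i

  dEdge : ℕ → ℕ → ℕ → Zζ
  dEdge k i j = edge k (dL i j) (i + j)

  bottomEdge : ℕ → Zζ
  bottomEdge i = edge 3 (hL i 0) i

  rhombus : ℕ → ℕ → Zζ
  rhombus i j = rhombusAT P i j c jj

  -- The middle edge has weight 0, so only the four sides contribute.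
  rhombus-sides : ∀ i j →
    rhombus i j ≡ (aEdge 1 i j ⊹ aEdge 7 i (suc j)) ⊹ (dEdge 11 i (suc j) ⊹ dEdge 5 (suc i) j)
  rhombus-sides i j =
    solve 4 (λ a7 d11 a1 d5 → ((((id ⊛ a7) ⊛ d11) ⊛ a1) ⊛ d5) ⊛ id ⊜ (a1 ⊛ a7) ⊛ (d11 ⊛ d5)) refl
      (aEdge 7 i (suc j)) (dEdge 11 i (suc j)) (aEdge 1 i j) (dEdge 5 (suc i) j)

  -- A rhombus whose opposite sides carry equal labels has aura 0: opposite
  -- sides have the same weight and opposite normals.
  symmetric-rhombus : ∀ i j → aL i (suc j) ≡ aL i j → dL i (suc j) ≡ dL (suc i) j → rhombus i j ≡ 0ζ
  symmetric-rhombus i j aEq dEq = begin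
      rhombus i j
    ≡⟨ rhombus-sides i j ⟩
      (aEdge 1 i j ⊹ aEdge 7 i (suc j)) ⊹ (dEdge 11 i (suc j) ⊹ dEdge 5 (suc i) j)
    ≡⟨ cong₂ (λ a d → (aEdge 1 i j ⊹ a) ⊹ (d ⊹ dEdge 5 (suc i) j))
         (cong (λ L → edge 7 L i) aEq) (cong₂ (edge 11) dEq (ℕP.+-suc i j)) ⟩
      (aEdge 1 i j ⊹ aEdge 7 i j) ⊹ (dEdge 11 (suc i) j ⊹ dEdge 5 (suc i) j)
    ≡⟨ cong₂ _⊹_ (trans (⊹-comm (aEdge 1 i j) (aEdge 7 i j)) (edge-opposite 1 (aL i j) i))
                 (edge-opposite 5 (dL (suc i) j) (suc i + j)) ⟩
      0ζ ∎

  non-scab : ∀ i j → i + j + 2 ≤ suc n' →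
    not (equiv i j) ∧ not (does (aL i j F.≟ aL i (suc j)) ∧ does (dL (suc i) j F.≟ dL i (suc j)))
      ≡ false →
    rhombus i j ≡ 0ζ
  non-scab i j inside with equiv i j in isEquiv | aL i j F.≟ aL i (suc j) | dL (suc i) j F.≟ dL i (suc j)
  ... | true | _ | _ = λ _ → let _ , dEq , aEq = rhombusEquiv i j inside isEquiv in symmetric-rhombus i j aEq dEq
  ... | false | yes aEq | yes dEq = λ _ → symmetric-rhombus i j (sym aEq) (sym dEq)
  ... | false | yes _ | no _ = λ ()
  ... | false | no _ | _ = λ ()

  scab-term : ∀ i j → i + j + 2 ≤ suc n' →
    (if isScab P i j then rhombusAT P i j else 0L) c jj ≡ rhombus i j
  scab-term i j inside with isScab P i j in scab
  ... | true = refl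
  ... | false = sym (non-scab i j inside scab)

  scabSum-all-rhombi : scabSum P c jj ≡ sumζ n' (λ i → sumζ (n' ∸ i) (rhombus i))
  scabSum-all-rhombi = begin
      scabSum P c jj
    ≡⟨ sumRange-coeff n' _ c jj ⟩
      sumζ n' (λ i → sumRange (n' ∸ i) (λ j → if isScab P i j then rhombusAT P i j else 0L) c jj)
    ≡⟨ sum-cong n' (λ i i<n' → trans (sumRange-coeff (n' ∸ i) _ c jj)
         (sum-cong (n' ∸ i) (λ j j<K → scab-term i j (rhombus-inside n' i j i<n' j<K)))) ⟩
      sumζ n' (λ i → sumζ (n' ∸ i) (rhombus i)) ∎

  bottom-triangle : ∀ N → N ≤ n' → bottomEdge N ⊹ aEdge 7 N 0 ⊹ dEdge 11 N 0 ≡ 0ζ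
  bottom-triangle N N≤n' =
    trans (cong (λ i → bottomEdge N ⊹ aEdge 7 N 0 ⊹ edge 11 (dL N 0) i) (ℕP.+-identityʳ N))
          (piece-aura N (bottomPiece N (s≤s N≤n')))

  column : ℕ → ℕ → Zζ
  column k N = sumζ (suc n' ∸ N) (dEdge k N)

  -- Each column is seen from its two sides with opposite normals.
  column-cancel : ∀ N → column 11 N ⊹ column 5 N ≡ 0ζ
  column-cancel N = trans (sym (sum-⊹ (suc n' ∸ N) (dEdge 11 N) (dEdge 5 N)))
    (sum-zero (suc n' ∸ N) (λ j _ → edge-opposite 5 (dL N j) (N + j)))

  -- The rhombi (N,j) form the strip between columns N and N+1.  Together
  -- with the bottom triangle (N,0), whose aura vanishes, their aura is that
  -- of the strip's boundary: the right-border edge A N (n'−N), the bottom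
  -- edge H N 0 and the two columns (the NW–SE edges inside telescope away).
  strip : ∀ N → N ≤ n' →
    sumζ (n' ∸ N) (rhombus N) ≡ (aEdge 7 N (n' ∸ N) ⊹ bottomEdge N) ⊹ (column 11 N ⊹ column 5 (suc N))
  strip N N≤n' = begin
      sumζ K (rhombus N)
    ≡⟨ trans (sum-cong K (λ j _ → rhombus-sides N j)) (sum-⊹ K _ _) ⟩
      sumζ K (λ j → aEdge 1 N j ⊹ aEdge 7 N (suc j)) ⊹ sumζ K (λ j → dEdge 11 N (suc j) ⊹ dEdge 5 (suc N) j)
    ≡⟨ cong₂ _⊹_ (telescope (aEdge 1 N) (aEdge 7 N) crossing K) (sum-⊹ K _ _) ⟩
      (aEdge 1 N 0 ⊹ aEdge 7 N K) ⊹ (SD ⊹ SD')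
    ≡⟨ sym (trans (cong (((aEdge 1 N 0 ⊹ aEdge 7 N K) ⊹ (SD ⊹ SD')) ⊹_) (bottom-triangle N N≤n'))
                  (⊹-identityʳ _)) ⟩
      ((aEdge 1 N 0 ⊹ aEdge 7 N K) ⊹ (SD ⊹ SD')) ⊹ (bottomEdge N ⊹ aEdge 7 N 0 ⊹ dEdge 11 N 0)
    ≡⟨ solve 7 (λ a1 aK sd sd' h a0 d0 →
          ((a1 ⊛ aK) ⊛ (sd ⊛ sd')) ⊛ ((h ⊛ a0) ⊛ d0) ⊜ ((a1 ⊛ a0) ⊛ (aK ⊛ h)) ⊛ ((d0 ⊛ sd) ⊛ sd'))
         refl (aEdge 1 N 0) (aEdge 7 N K) SD SD' (bottomEdge N) (aEdge 7 N 0) (dEdge 11 N 0) ⟩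
      ((aEdge 1 N 0 ⊹ aEdge 7 N 0) ⊹ (aEdge 7 N K ⊹ bottomEdge N)) ⊹ ((dEdge 11 N 0 ⊹ SD) ⊹ SD')
    ≡⟨ cong₂ (λ z d → (z ⊹ (aEdge 7 N K ⊹ bottomEdge N)) ⊹ (d ⊹ SD')) (crossing 0) (sym column-11) ⟩
      (0ζ ⊹ (aEdge 7 N K ⊹ bottomEdge N)) ⊹ (column 11 N ⊹ column 5 (suc N))
    ≡⟨ cong (_⊹ (column 11 N ⊹ column 5 (suc N))) (⊹-identityˡ (aEdge 7 N K ⊹ bottomEdge N)) ⟩
      (aEdge 7 N K ⊹ bottomEdge N) ⊹ (column 11 N ⊹ column 5 (suc N)) ∎
    where
    K = n' ∸ N
    SD = sumζ K (λ j → dEdge 11 N (suc j))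
    SD' = sumζ K (dEdge 5 (suc N))
    -- the NW–SE edge A N j is shared by the rhombi (N,j−1) and (N,j)
    crossing : ∀ j → aEdge 1 N j ⊹ aEdge 7 N j ≡ 0ζ
    crossing j = trans (⊹-comm (aEdge 1 N j) (aEdge 7 N j)) (edge-opposite 1 (aL N j) N)
    column-11 : column 11 N ≡ dEdge 11 N 0 ⊹ SD
    column-11 = trans (cong (λ L → sumζ L (dEdge 11 N)) (ℕP.+-∸-assoc 1 N≤n')) (sum-first K (dEdge 11 N))

  boundaryAura : Zζ
  boundaryAura = sumζ (suc n') (λ N → aEdge 7 N (n' ∸ N) ⊹ bottomEdge N) ⊹ column 11 0

  -- Summing the strips, the columns telescope to the left border: the
  -- total aura of the small vertical rhombi is the aura of the boundary.
  rhombi-boundary : sumζ n' (λ i → sumζ (n' ∸ i) (rhombus i)) ≡ boundaryAura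
  rhombi-boundary = begin
      sumζ n' strips
    ≡⟨ sym (trans (cong (λ K → sumζ n' strips ⊹ sumζ K (rhombus n')) (ℕP.n∸n≡0 n'))
                  (⊹-identityʳ (sumζ n' strips))) ⟩
      sumζ (suc n') strips
    ≡⟨ sum-cong (suc n') (λ N N<1+n' → strip N (ℕP.≤-pred N<1+n')) ⟩
      sumζ (suc n') (λ N → rightBottom N ⊹ (column 11 N ⊹ column 5 (suc N)))
    ≡⟨ sum-⊹ (suc n') rightBottom (λ N → column 11 N ⊹ column 5 (suc N)) ⟩
      sumζ (suc n') rightBottom ⊹ sumζ (suc n') (λ N → column 11 N ⊹ column 5 (suc N))
    ≡⟨ cong (sumζ (suc n') rightBottom ⊹_) (telescope (column 11) (column 5) column-cancel (suc n')) ⟩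
      sumζ (suc n') rightBottom ⊹ (column 11 0 ⊹ column 5 (suc n'))
    ≡⟨ cong (λ K → sumζ (suc n') rightBottom ⊹ (column 11 0 ⊹ sumζ K (dEdge 5 (suc n'))))
         (ℕP.n∸n≡0 n') ⟩
      sumζ (suc n') rightBottom ⊹ (column 11 0 ⊹ 0ζ)
    ≡⟨ cong (sumζ (suc n') rightBottom ⊹_) (⊹-identityʳ (column 11 0)) ⟩
      boundaryAura ∎
    where
    strips : ℕ → Zζ
    strips i = sumζ (n' ∸ i) (rhombus i)
    rightBottom : ℕ → Zζ
    rightBottom N = aEdge 7 N (n' ∸ N) ⊹ bottomEdge N

  simple-edge : ∀ k L a → L ≡ simple a → edge k L m ≡ rot k (if does (a F.≟ c) then 1ζ else 0ζ)
  simple-edge k L a L≡a =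
    trans (edge-on k L) (cong (rot k) (trans (cong (λ L → auraCoeff L c) L≡a) (simple-aura a c)))

  -- On each border side exactly the m-th edge has weight y_{m+1}; its label
  -- is the m-th letter of u, v or w.
  boundary-coefficient : boundaryAura ≡ rot 11 (Cstr u c jj) ⊹ rot 7 (Cstr v c jj) ⊹ rot 3 (Cstr w c jj)
  boundary-coefficient = begin
      boundaryAura
    ≡⟨ cong₂ _⊹_
         (sum-single (suc n') _ m (FP.toℕ<n jj)
           (λ N N≢m → cong₂ _⊹_ (edge-off 7 (aL N (n' ∸ N)) N N≢m) (edge-off 3 (hL N 0) N N≢m)))
         (sum-single (suc n') _ m (FP.toℕ<n jj) (λ j j≢m → edge-off 11 (dL 0 j) j j≢m)) ⟩
      (aEdge 7 m (n' ∸ m) ⊹ bottomEdge m) ⊹ dEdge 11 0 m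
    ≡⟨ cong₂ _⊹_ (cong₂ _⊹_ (simple-edge 7 _ (v jj) (rightBoundary jj))
                            (simple-edge 3 _ (w jj) (bottomBoundary jj)))
                 (simple-edge 11 _ (u jj) (leftBoundary jj)) ⟩
      (rot 7 (Cstr v c jj) ⊹ rot 3 (Cstr w c jj)) ⊹ rot 11 (Cstr u c jj)
    ≡⟨ solve 3 (λ v w u → (v ⊛ w) ⊛ u ⊜ (u ⊛ v) ⊛ w) refl
         (rot 7 (Cstr v c jj)) (rot 3 (Cstr w c jj)) (rot 11 (Cstr u c jj)) ⟩
      rot 11 (Cstr u c jj) ⊹ rot 7 (Cstr v c jj) ⊹ rot 3 (Cstr w c jj) ∎

-- Proposition 5.5.
proposition5p5 : (a b n : ℕ) → a ≤ b → b ≤ n →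
    (u v w : Fin n → Fin 3) →
    Is012String a b n u → Is012String a b n v → Is012String a b n w →
    (P : EqPuzzle n u v w) →
    ∀ c j → scabSum P c j
      ≡ (scaleL 11 (Cstr u) ⊕ scaleL 7 (Cstr v) ⊕ scaleL 3 (Cstr w)) c j
proposition5p5 a b zero _ _ u v w _ _ _ P c ()
proposition5p5 a b (suc n') _ _ u v w _ _ _ P c j = begin
    scabSum P c j
  ≡⟨ scabSum-all-rhombi ⟩
    sumζ n' (λ i → sumζ (n' ∸ i) (rhombus i))
  ≡⟨ rhombi-boundary ⟩
    boundaryAura
  ≡⟨ boundary-coefficient ⟩
    rot 11 (Cstr u c j) ⊹ rot 7 (Cstr v c j) ⊹ rot 3 (Cstr w c j) ∎
  where
  open CoefficientOf P c j
  open ≡-Reasoning
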